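{- Let $\mathbf{I}_{2,0}$ be the variety of implication zroupoids satisfying $x''\approx x$. Then: (i) for every $\mathbf A\in\mathbf{I}_{2,0}$, the relation $\sqsubseteq$ on $A$ is a partial order; and (ii) if $\mathbf V$ is any subvariety of $\mathbf I$ such that $\sqsubseteq$ is a partial order on every algebra in $\mathbf V$, then $\mathbf V\subseteq\mathbf{I}_{2,0}$. That is, $\mathbf{I}_{2,0}$ is a maximal subvariety of $\mathbf I$ with respect to the property that $\sqsubseteq$ is a partial order on its members.
   Context: A zroupoid is an algebra $\mathbf A=\langle A,\to,0\rangle$ with a binary operation $\to$ and a constant $0$; write $x':=x\to 0$. An implication zroupoid (I-zroupoid) is a zroupoid satisfying the identities (I) $(x\to y)\to z\approx[(z'\to x)\to(y\to z)']'$ and $0''\approx 0$. $\mathbf I$ denotes the variety of I-zroupoids, and $\mathbf{I}_{2,0}$ the subvariety of $\mathbf I$ defined by $x''\approx x$. For $\mathbf A\in\mathbf I$ and $x,y\in A$, define $x\sqsubseteq y$ iff $(x\to y')'=x$. -}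

module Defs where

open import Data.Nat using (ℕ)
open import Data.Product using (_×_)
open import Relation.Binary.PropositionalEquality using (_≡_)

record Zroupoid : Set₁ where
  field
    Carrier : Set
    _⇒_     : Carrier → Carrier → Carrier
    𝟘       : Carrier

  infixr 5 _⇒_

  _′ : Carrier → Carrier
  x ′ = x ⇒ 𝟘

  _⊑_ : Carrier → Carrier → Set
  x ⊑ y = ((x ⇒ (y ′)) ′) ≡ x

data Term : Set where
  var  : ℕ → Term
  _⟶_  : Term → Term → Term
  zero : Term

⟦_⟧ : (A : Zroupoid) → Term → (ℕ → Zroupoid.Carrier A) → Zroupoid.Carrier A
⟦ A ⟧ (var n)   ρ = ρ n
⟦ A ⟧ (s ⟶ t)   ρ = Zroupoid._⇒_ A (⟦ A ⟧ s ρ) (⟦ A ⟧ t ρ)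
⟦ A ⟧ zero      ρ = Zroupoid.𝟘 A

_⊨_≈_ : Zroupoid → Term → Term → Set
A ⊨ s ≈ t = ∀ (ρ : ℕ → Zroupoid.Carrier A) → ⟦ A ⟧ s ρ ≡ ⟦ A ⟧ t ρ

Identities : Set₁
Identities = Term → Term → Set

_⊨ₛ_ : Zroupoid → Identities → Set
A ⊨ₛ Σ = ∀ s t → Σ s t → A ⊨ s ≈ t

IsIZroupoid : Zroupoid → Set
IsIZroupoid A =
  (∀ x y z → ((x ⇒ y) ⇒ z) ≡ (((((z ′) ⇒ x) ⇒ ((y ⇒ z) ′)) ′)))
  × (((𝟘 ′) ′) ≡ 𝟘)
  where open Zroupoid A

IsI20 : Zroupoid → Set
IsI20 A = IsIZroupoid A × (∀ x → ((x ′) ′) ≡ x)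
  where open Zroupoid A

-- Subvarieties of I are exactly the classes V(Σ) of I-zroupoids satisfying a
-- set of identities Σ (Birkhoff's HSP theorem).
InSubvariety : Identities → Zroupoid → Set
InSubvariety Σ A = IsIZroupoid A × (A ⊨ₛ Σ)

module Submission where

-- Write x ∨ y := x ′ ⇒ y and x ∧ y := (x ⇒ y ′) ′.  In an I-zroupoid with x ′ ′ ≈ x the
-- complement is an involution exchanging ∨ and ∧ (De Morgan), 𝟘 and 𝟙 := 𝟘 ′ are units of
-- ∨ and ∧, and the axiom (I) becomes the twisted distributive law
-- (x ∧ y) ∨ z ≈ (z ∨ x) ∧ (y ∨ z); moreover x ⊑ y says exactly x ∧ y = x.  Reflexivity of ⊑
-- is idempotence of ∧, antisymmetry follows from x ⊑ y ⇒ y ∧ x = x, and transitivity is an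
-- equational consequence of the twisted distributive law and its dual.
-- Conversely, reflexivity of ⊑ alone says x = (x ⇒ x ′) ′, i.e. every element is a
-- complement; together with (I) this gives x ′ ′ ′ ′ ≈ x ′ ′, hence x ′ ′ ′ ≈ x ′ and x ′ ′ ≈ x.

open import Defs
open import Data.Fin using (Fin; zero; suc)
open import Data.Nat using (ℕ; _+_)
open import Data.Product using (_×_; _,_; proj₁; proj₂)
open import Data.Vec using (Vec; []; _∷_; lookup; map)
open import Data.Vec.Properties using (lookup-map)
open import Relation.Binary.PropositionalEquality
  using (_≡_; refl; sym; trans; cong; cong₂; isEquivalence; module ≡-Reasoning)
open import Relation.Binary.Structures using (IsPartialOrder)

module IZroupoidProperties (A : Zroupoid) (isI : IsIZroupoid A) where
  open Zroupoid A
  open ≡-Reasoning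

  private
    axiom : ∀ x y z → (x ⇒ y) ⇒ z ≡ ((z ′ ⇒ x) ⇒ (y ⇒ z) ′) ′
    axiom = proj₁ isI

    𝟘′′ : 𝟘 ′ ′ ≡ 𝟘
    𝟘′′ = proj₂ isI

  [𝟘′⇒x]′′≡x′′ : ∀ x → (𝟘 ′ ⇒ x) ′ ′ ≡ x ′ ′
  [𝟘′⇒x]′′≡x′′ x = sym (begin
    (x ⇒ 𝟘) ⇒ 𝟘                   ≡⟨ axiom x 𝟘 𝟘 ⟩
    ((𝟘 ′ ⇒ x) ⇒ 𝟘 ′ ′) ′         ≡⟨ cong (λ h → ((𝟘 ′ ⇒ x) ⇒ h) ′) 𝟘′′ ⟩
    (𝟘 ′ ⇒ x) ′ ′                 ∎)

  module Reflexive (⊑-refl : ∀ x → x ⊑ x) where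

    x′⇒𝟘′≡[𝟘⇒x]′′ : ∀ x → x ′ ⇒ 𝟘 ′ ≡ (𝟘 ⇒ x) ′ ′
    x′⇒𝟘′≡[𝟘⇒x]′′ x = begin
      (x ⇒ 𝟘) ⇒ 𝟘 ′                   ≡⟨ axiom x 𝟘 (𝟘 ′) ⟩
      ((𝟘 ′ ′ ⇒ x) ⇒ (𝟘 ⇒ 𝟘 ′) ′) ′   ≡⟨ cong₂ (λ u v → ((u ⇒ x) ⇒ v) ′) 𝟘′′ (⊑-refl 𝟘) ⟩
      (𝟘 ⇒ x) ′ ′                     ∎

    𝟘′⇒𝟘′≡𝟘′ : 𝟘 ′ ⇒ 𝟘 ′ ≡ 𝟘 ′
    𝟘′⇒𝟘′≡𝟘′ = trans (x′⇒𝟘′≡[𝟘⇒x]′′ 𝟘) (cong _′ 𝟘′′)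

    [𝟘′⇒x′′]′≡[𝟘′⇒x]′ : ∀ x → (𝟘 ′ ⇒ x ′ ′) ′ ≡ (𝟘 ′ ⇒ x) ′
    [𝟘′⇒x′′]′≡[𝟘′⇒x]′ x = sym (begin
      (𝟘 ′ ⇒ x) ⇒ 𝟘                   ≡⟨ axiom (𝟘 ′) x 𝟘 ⟩
      ((𝟘 ′ ⇒ 𝟘 ′) ⇒ x ′ ′) ′         ≡⟨ cong (λ h → (h ⇒ x ′ ′) ′) 𝟘′⇒𝟘′≡𝟘′ ⟩
      (𝟘 ′ ⇒ x ′ ′) ′                 ∎)

    x′′′′≡x′′ : ∀ x → x ′ ′ ′ ′ ≡ x ′ ′
    x′′′′≡x′′ x = begin
      x ′ ′ ′ ′                       ≡⟨ sym ([𝟘′⇒x]′′≡x′′ (x ′ ′)) ⟩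
      (𝟘 ′ ⇒ x ′ ′) ′ ′               ≡⟨ cong _′ ([𝟘′⇒x′′]′≡[𝟘′⇒x]′ x) ⟩
      (𝟘 ′ ⇒ x) ′ ′                   ≡⟨ [𝟘′⇒x]′′≡x′′ x ⟩
      x ′ ′                           ∎

    x′′′≡x′ : ∀ x → x ′ ′ ′ ≡ x ′
    x′′′≡x′ x = begin
      x ′ ′ ′                         ≡⟨ cong (λ h → h ′ ′ ′) (sym (⊑-refl x)) ⟩
      (x ⇒ x ′) ′ ′ ′ ′               ≡⟨ x′′′′≡x′′ (x ⇒ x ′) ⟩
      (x ⇒ x ′) ′ ′                   ≡⟨ cong _′ (⊑-refl x) ⟩
      x ′                             ∎

    ′-involutive : ∀ x → x ′ ′ ≡ x
    ′-involutive x = begin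
      x ′ ′                           ≡⟨ cong (λ h → h ′ ′) (sym (⊑-refl x)) ⟩
      (x ⇒ x ′) ′ ′ ′                 ≡⟨ x′′′≡x′ (x ⇒ x ′) ⟩
      (x ⇒ x ′) ′                     ≡⟨ ⊑-refl x ⟩
      x                               ∎

module I20Properties (A : Zroupoid) (isI20 : IsI20 A) where
  open Zroupoid A
  open IZroupoidProperties A (proj₁ isI20) using ([𝟘′⇒x]′′≡x′′)
  open ≡-Reasoning

  private
    axiom : ∀ x y z → (x ⇒ y) ⇒ z ≡ ((z ′ ⇒ x) ⇒ (y ⇒ z) ′) ′
    axiom = proj₁ (proj₁ isI20)

  ′-involutive : ∀ x → x ′ ′ ≡ x
  ′-involutive = proj₂ isI20

  infixr 6 _∨_
  infixr 7 _∧_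

  𝟙 : Carrier
  𝟙 = 𝟘 ′

  _∨_ : Carrier → Carrier → Carrier
  x ∨ y = x ′ ⇒ y

  _∧_ : Carrier → Carrier → Carrier
  x ∧ y = (x ⇒ y ′) ′

  ∨-identityʳ : ∀ x → x ∨ 𝟘 ≡ x
  ∨-identityʳ = ′-involutive

  ∨-identityˡ : ∀ x → 𝟘 ∨ x ≡ x
  ∨-identityˡ x = begin
    𝟘 ′ ⇒ x            ≡⟨ sym (′-involutive _) ⟩
    (𝟘 ′ ⇒ x) ′ ′      ≡⟨ [𝟘′⇒x]′′≡x′′ x ⟩
    x ′ ′              ≡⟨ ′-involutive x ⟩
    x                  ∎

  ∧-identityˡ : ∀ x → 𝟙 ∧ x ≡ x
  ∧-identityˡ x = trans (cong _′ (∨-identityˡ (x ′))) (′-involutive x)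

  ∧-identityʳ : ∀ x → x ∧ 𝟙 ≡ x
  ∧-identityʳ x = trans (cong (λ h → (x ⇒ h) ′) (′-involutive 𝟘)) (′-involutive x)

  ∨-deMorgan : ∀ x y → (x ∨ y) ′ ≡ x ′ ∧ y ′
  ∨-deMorgan x y = cong (λ h → (x ′ ⇒ h) ′) (sym (′-involutive y))

  ∧-deMorgan : ∀ x y → (x ∧ y) ′ ≡ x ′ ∨ y ′
  ∧-deMorgan x y = trans (′-involutive _) (cong (_⇒ y ′) (sym (′-involutive x)))

  ∨-distribʳ-∧ : ∀ x y z → (x ∧ y) ∨ z ≡ (z ∨ x) ∧ (y ∨ z)
  ∨-distribʳ-∧ x y z = trans (cong (_⇒ z) (′-involutive _)) (axiom x (y ′) z)

  -- Terms over ∨, ∧, 𝟘, 𝟙, used to state the De Morgan duality principle once and for all.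
  infixr 6 _∨ᵉ_
  infixr 7 _∧ᵉ_

  data Expr (n : ℕ) : Set where
    var       : Fin n → Expr n
    _∨ᵉ_ _∧ᵉ_ : Expr n → Expr n → Expr n
    𝟘ᵉ 𝟙ᵉ     : Expr n

  v₀ : ∀ {n} → Expr (1 + n)
  v₀ = var zero

  v₁ : ∀ {n} → Expr (2 + n)
  v₁ = var (suc zero)

  v₂ : ∀ {n} → Expr (3 + n)
  v₂ = var (suc (suc zero))

  ⟦_⟧ᵉ : ∀ {n} → Expr n → Vec Carrier n → Carrier
  ⟦ var i ⟧ᵉ  ρ = lookup ρ i
  ⟦ s ∨ᵉ t ⟧ᵉ ρ = ⟦ s ⟧ᵉ ρ ∨ ⟦ t ⟧ᵉ ρ
  ⟦ s ∧ᵉ t ⟧ᵉ ρ = ⟦ s ⟧ᵉ ρ ∧ ⟦ t ⟧ᵉ ρ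
  ⟦ 𝟘ᵉ ⟧ᵉ     ρ = 𝟘
  ⟦ 𝟙ᵉ ⟧ᵉ     ρ = 𝟙

  dual : ∀ {n} → Expr n → Expr n
  dual (var i)  = var i
  dual (s ∨ᵉ t) = dual s ∧ᵉ dual t
  dual (s ∧ᵉ t) = dual s ∨ᵉ dual t
  dual 𝟘ᵉ       = 𝟙ᵉ
  dual 𝟙ᵉ       = 𝟘ᵉ

  ⟦dual⟧ : ∀ {n} (e : Expr n) ρ → ⟦ dual e ⟧ᵉ ρ ≡ ⟦ e ⟧ᵉ (map _′ ρ) ′
  ⟦dual⟧ (var i)  ρ = begin
    lookup ρ i                              ≡⟨ sym (′-involutive _) ⟩
    lookup ρ i ′ ′                          ≡⟨ cong _′ (sym (lookup-map i _′ ρ)) ⟩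
    lookup (map _′ ρ) i ′                   ∎
  ⟦dual⟧ (s ∨ᵉ t) ρ = begin
    ⟦ dual s ⟧ᵉ ρ ∧ ⟦ dual t ⟧ᵉ ρ           ≡⟨ cong₂ _∧_ (⟦dual⟧ s ρ) (⟦dual⟧ t ρ) ⟩
    ⟦ s ⟧ᵉ (map _′ ρ) ′ ∧ ⟦ t ⟧ᵉ (map _′ ρ) ′ ≡⟨ sym (∨-deMorgan _ _) ⟩
    (⟦ s ⟧ᵉ (map _′ ρ) ∨ ⟦ t ⟧ᵉ (map _′ ρ)) ′ ∎
  ⟦dual⟧ (s ∧ᵉ t) ρ = begin
    ⟦ dual s ⟧ᵉ ρ ∨ ⟦ dual t ⟧ᵉ ρ           ≡⟨ cong₂ _∨_ (⟦dual⟧ s ρ) (⟦dual⟧ t ρ) ⟩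
    ⟦ s ⟧ᵉ (map _′ ρ) ′ ∨ ⟦ t ⟧ᵉ (map _′ ρ) ′ ≡⟨ sym (∧-deMorgan _ _) ⟩
    (⟦ s ⟧ᵉ (map _′ ρ) ∧ ⟦ t ⟧ᵉ (map _′ ρ)) ′ ∎
  ⟦dual⟧ 𝟘ᵉ ρ = refl
  ⟦dual⟧ 𝟙ᵉ ρ = sym (′-involutive 𝟘)

  duality : ∀ {n} (s t : Expr n) → (∀ ρ → ⟦ s ⟧ᵉ ρ ≡ ⟦ t ⟧ᵉ ρ) → ∀ ρ → ⟦ dual s ⟧ᵉ ρ ≡ ⟦ dual t ⟧ᵉ ρ
  duality s t s≡t ρ = begin
    ⟦ dual s ⟧ᵉ ρ              ≡⟨ ⟦dual⟧ s ρ ⟩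
    ⟦ s ⟧ᵉ (map _′ ρ) ′        ≡⟨ cong _′ (s≡t (map _′ ρ)) ⟩
    ⟦ t ⟧ᵉ (map _′ ρ) ′        ≡⟨ sym (⟦dual⟧ t ρ) ⟩
    ⟦ dual t ⟧ᵉ ρ              ∎

  duality₁ : (s t : Expr 1) → (∀ x → ⟦ s ⟧ᵉ (x ∷ []) ≡ ⟦ t ⟧ᵉ (x ∷ [])) →
             ∀ x → ⟦ dual s ⟧ᵉ (x ∷ []) ≡ ⟦ dual t ⟧ᵉ (x ∷ [])
  duality₁ s t s≡t x = duality s t (λ { (x ∷ []) → s≡t x }) (x ∷ [])

  duality₂ : (s t : Expr 2) → (∀ x y → ⟦ s ⟧ᵉ (x ∷ y ∷ []) ≡ ⟦ t ⟧ᵉ (x ∷ y ∷ [])) →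
             ∀ x y → ⟦ dual s ⟧ᵉ (x ∷ y ∷ []) ≡ ⟦ dual t ⟧ᵉ (x ∷ y ∷ [])
  duality₂ s t s≡t x y = duality s t (λ { (x ∷ y ∷ []) → s≡t x y }) (x ∷ y ∷ [])

  duality₃ : (s t : Expr 3) → (∀ x y z → ⟦ s ⟧ᵉ (x ∷ y ∷ z ∷ []) ≡ ⟦ t ⟧ᵉ (x ∷ y ∷ z ∷ [])) →
             ∀ x y z → ⟦ dual s ⟧ᵉ (x ∷ y ∷ z ∷ []) ≡ ⟦ dual t ⟧ᵉ (x ∷ y ∷ z ∷ [])
  duality₃ s t s≡t x y z = duality s t (λ { (x ∷ y ∷ z ∷ []) → s≡t x y z }) (x ∷ y ∷ z ∷ [])

  ∧-distribʳ-∨ : ∀ x y z → (x ∨ y) ∧ z ≡ (z ∧ x) ∨ (y ∧ z)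
  ∧-distribʳ-∨ = duality₃ ((v₀ ∧ᵉ v₁) ∨ᵉ v₂) ((v₂ ∨ᵉ v₀) ∧ᵉ (v₁ ∨ᵉ v₂)) ∨-distribʳ-∧

  x∧𝟘∨y≡[y∨x]∧y : ∀ x y → (x ∧ 𝟘) ∨ y ≡ (y ∨ x) ∧ y
  x∧𝟘∨y≡[y∨x]∧y x y = begin
    (x ∧ 𝟘) ∨ y        ≡⟨ ∨-distribʳ-∧ x 𝟘 y ⟩
    (y ∨ x) ∧ (𝟘 ∨ y)  ≡⟨ cong ((y ∨ x) ∧_) (∨-identityˡ y) ⟩
    (y ∨ x) ∧ y        ∎

  [x∨𝟙]∧y≡y∧x∨y : ∀ x y → (x ∨ 𝟙) ∧ y ≡ (y ∧ x) ∨ y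
  [x∨𝟙]∧y≡y∧x∨y = duality₂ ((v₀ ∧ᵉ 𝟘ᵉ) ∨ᵉ v₁) ((v₁ ∨ᵉ v₀) ∧ᵉ v₁) x∧𝟘∨y≡[y∨x]∧y

  x∧𝟘∨𝟙≡𝟙∨x : ∀ x → (x ∧ 𝟘) ∨ 𝟙 ≡ 𝟙 ∨ x
  x∧𝟘∨𝟙≡𝟙∨x x = begin
    (x ∧ 𝟘) ∨ 𝟙  ≡⟨ x∧𝟘∨y≡[y∨x]∧y x 𝟙 ⟩
    (𝟙 ∨ x) ∧ 𝟙  ≡⟨ ∧-identityʳ (𝟙 ∨ x) ⟩
    𝟙 ∨ x        ∎

  [x∨𝟙]∧𝟘≡𝟘∧x : ∀ x → (x ∨ 𝟙) ∧ 𝟘 ≡ 𝟘 ∧ x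
  [x∨𝟙]∧𝟘≡𝟘∧x = duality₁ ((v₀ ∧ᵉ 𝟘ᵉ) ∨ᵉ 𝟙ᵉ) (𝟙ᵉ ∨ᵉ v₀) x∧𝟘∨𝟙≡𝟙∨x

  x∨𝟙≡𝟙∨x : ∀ x → x ∨ 𝟙 ≡ 𝟙 ∨ x
  x∨𝟙≡𝟙∨x x = begin
    x ∨ 𝟙                    ≡⟨ cong (_∨ 𝟙) (sym (∧-identityʳ x)) ⟩
    (x ∧ 𝟙) ∨ 𝟙              ≡⟨ ∨-distribʳ-∧ x 𝟙 𝟙 ⟩
    (𝟙 ∨ x) ∧ (𝟙 ∨ 𝟙)        ≡⟨ cong ((𝟙 ∨ x) ∧_) (sym (x∧𝟘∨𝟙≡𝟙∨x 𝟙)) ⟩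
    (𝟙 ∨ x) ∧ ((𝟙 ∧ 𝟘) ∨ 𝟙)  ≡⟨ cong (λ h → (𝟙 ∨ x) ∧ (h ∨ 𝟙)) (∧-identityˡ 𝟘) ⟩
    (𝟙 ∨ x) ∧ (𝟘 ∨ 𝟙)        ≡⟨ cong ((𝟙 ∨ x) ∧_) (∨-identityˡ 𝟙) ⟩
    (𝟙 ∨ x) ∧ 𝟙              ≡⟨ ∧-identityʳ (𝟙 ∨ x) ⟩
    𝟙 ∨ x                    ∎

  x∧𝟘≡𝟘∧x : ∀ x → x ∧ 𝟘 ≡ 𝟘 ∧ x
  x∧𝟘≡𝟘∧x = duality₁ (v₀ ∨ᵉ 𝟙ᵉ) (𝟙ᵉ ∨ᵉ v₀) x∨𝟙≡𝟙∨x

  x∨y≡[y∨x]∧[y∨𝟙] : ∀ x y → x ∨ y ≡ (y ∨ x) ∧ (y ∨ 𝟙)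
  x∨y≡[y∨x]∧[y∨𝟙] x y = begin
    x ∨ y              ≡⟨ cong (_∨ y) (sym (∧-identityʳ x)) ⟩
    (x ∧ 𝟙) ∨ y        ≡⟨ ∨-distribʳ-∧ x 𝟙 y ⟩
    (y ∨ x) ∧ (𝟙 ∨ y)  ≡⟨ cong ((y ∨ x) ∧_) (sym (x∨𝟙≡𝟙∨x y)) ⟩
    (y ∨ x) ∧ (y ∨ 𝟙)  ∎

  x∧y≡y∧x∨y∧𝟘 : ∀ x y → x ∧ y ≡ (y ∧ x) ∨ (y ∧ 𝟘)
  x∧y≡y∧x∨y∧𝟘 = duality₂ (v₀ ∨ᵉ v₁) ((v₁ ∨ᵉ v₀) ∧ᵉ (v₁ ∨ᵉ 𝟙ᵉ)) x∨y≡[y∨x]∧[y∨𝟙]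

  x∨x≡x : ∀ x → x ∨ x ≡ x
  x∨x≡x x = begin
    x ∨ x              ≡⟨ cong (_∨ x) (sym (∧-identityʳ x)) ⟩
    (x ∧ 𝟙) ∨ x        ≡⟨ sym ([x∨𝟙]∧y≡y∧x∨y 𝟙 x) ⟩
    (𝟙 ∨ 𝟙) ∧ x        ≡⟨ cong (_∧ x) (sym (x∧𝟘∨𝟙≡𝟙∨x 𝟙)) ⟩
    ((𝟙 ∧ 𝟘) ∨ 𝟙) ∧ x  ≡⟨ cong (λ h → (h ∨ 𝟙) ∧ x) (∧-identityˡ 𝟘) ⟩
    (𝟘 ∨ 𝟙) ∧ x        ≡⟨ cong (_∧ x) (∨-identityˡ 𝟙) ⟩
    𝟙 ∧ x              ≡⟨ ∧-identityˡ x ⟩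
    x                  ∎

  x∧x≡x : ∀ x → x ∧ x ≡ x
  x∧x≡x = duality₁ (v₀ ∨ᵉ v₀) v₀ x∨x≡x

  x∧y∨y≡x∧𝟘∨y : ∀ x y → (x ∧ y) ∨ y ≡ (x ∧ 𝟘) ∨ y
  x∧y∨y≡x∧𝟘∨y x y = begin
    (x ∧ y) ∨ y        ≡⟨ ∨-distribʳ-∧ x y y ⟩
    (y ∨ x) ∧ (y ∨ y)  ≡⟨ cong ((y ∨ x) ∧_) (x∨x≡x y) ⟩
    (y ∨ x) ∧ y        ≡⟨ sym (x∧𝟘∨y≡[y∨x]∧y x y) ⟩
    (x ∧ 𝟘) ∨ y        ∎

  𝟘∧x∨y≡y∧[x∨y] : ∀ x y → (𝟘 ∧ x) ∨ y ≡ y ∧ (x ∨ y)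
  𝟘∧x∨y≡y∧[x∨y] x y = begin
    (𝟘 ∧ x) ∨ y        ≡⟨ ∨-distribʳ-∧ 𝟘 x y ⟩
    (y ∨ 𝟘) ∧ (x ∨ y)  ≡⟨ cong (_∧ (x ∨ y)) (∨-identityʳ y) ⟩
    y ∧ (x ∨ y)        ∎

  [𝟙∨x]∧y≡y∨x∧y : ∀ x y → (𝟙 ∨ x) ∧ y ≡ y ∨ (x ∧ y)
  [𝟙∨x]∧y≡y∨x∧y = duality₂ ((𝟘ᵉ ∧ᵉ v₀) ∨ᵉ v₁) (v₁ ∧ᵉ (v₀ ∨ᵉ v₁)) 𝟘∧x∨y≡y∧[x∨y]

  x∧y∨x≡𝟘∧y∨x : ∀ x y → (x ∧ y) ∨ x ≡ (𝟘 ∧ y) ∨ x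
  x∧y∨x≡𝟘∧y∨x x y = begin
    (x ∧ y) ∨ x        ≡⟨ ∨-distribʳ-∧ x y x ⟩
    (x ∨ x) ∧ (y ∨ x)  ≡⟨ cong (_∧ (y ∨ x)) (x∨x≡x x) ⟩
    x ∧ (y ∨ x)        ≡⟨ sym (𝟘∧x∨y≡y∧[x∨y] y x) ⟩
    (𝟘 ∧ y) ∨ x        ∎

  [x∨y]∧x≡[𝟙∨y]∧x : ∀ x y → (x ∨ y) ∧ x ≡ (𝟙 ∨ y) ∧ x
  [x∨y]∧x≡[𝟙∨y]∧x = duality₂ ((v₀ ∧ᵉ v₁) ∨ᵉ v₀) ((𝟘ᵉ ∧ᵉ v₁) ∨ᵉ v₀) x∧y∨x≡𝟘∧y∨x

  x∧y∨x≡y∧𝟘∨x : ∀ x y → (x ∧ y) ∨ x ≡ (y ∧ 𝟘) ∨ x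
  x∧y∨x≡y∧𝟘∨x x y = begin
    (x ∧ y) ∨ x  ≡⟨ sym ([x∨𝟙]∧y≡y∧x∨y y x) ⟩
    (y ∨ 𝟙) ∧ x  ≡⟨ cong (_∧ x) (x∨𝟙≡𝟙∨x y) ⟩
    (𝟙 ∨ y) ∧ x  ≡⟨ sym ([x∨y]∧x≡[𝟙∨y]∧x x y) ⟩
    (x ∨ y) ∧ x  ≡⟨ sym (x∧𝟘∨y≡[y∨x]∧y y x) ⟩
    (y ∧ 𝟘) ∨ x  ∎

  [x∨y]∧x≡[y∨𝟙]∧x : ∀ x y → (x ∨ y) ∧ x ≡ (y ∨ 𝟙) ∧ x
  [x∨y]∧x≡[y∨𝟙]∧x = duality₂ ((v₀ ∧ᵉ v₁) ∨ᵉ v₀) ((v₁ ∧ᵉ 𝟘ᵉ) ∨ᵉ v₀) x∧y∨x≡y∧𝟘∨x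

  x∧y∨x≡x∨y∧x : ∀ x y → (x ∧ y) ∨ x ≡ x ∨ (y ∧ x)
  x∧y∨x≡x∨y∧x x y = begin
    (x ∧ y) ∨ x        ≡⟨ x∧y∨x≡y∧𝟘∨x x y ⟩
    (y ∧ 𝟘) ∨ x        ≡⟨ x∧𝟘∨y≡[y∨x]∧y y x ⟩
    (x ∨ y) ∧ x        ≡⟨ ∧-distribʳ-∨ x y x ⟩
    (x ∧ x) ∨ (y ∧ x)  ≡⟨ cong (_∨ (y ∧ x)) (x∧x≡x x) ⟩
    x ∨ (y ∧ x)        ∎

  [x∨𝟙]∧y≡𝟘∧x∨y : ∀ x y → (x ∨ 𝟙) ∧ y ≡ (𝟘 ∧ x) ∨ y
  [x∨𝟙]∧y≡𝟘∧x∨y x y = begin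
    (x ∨ 𝟙) ∧ y        ≡⟨ [x∨𝟙]∧y≡y∧x∨y x y ⟩
    (y ∧ x) ∨ y        ≡⟨ ∨-distribʳ-∧ y x y ⟩
    (y ∨ y) ∧ (x ∨ y)  ≡⟨ cong (_∧ (x ∨ y)) (x∨x≡x y) ⟩
    y ∧ (x ∨ y)        ≡⟨ sym (𝟘∧x∨y≡y∧[x∨y] x y) ⟩
    (𝟘 ∧ x) ∨ y        ∎

  x∨y∧x≡𝟘∧y∨x : ∀ x y → x ∨ (y ∧ x) ≡ (𝟘 ∧ y) ∨ x
  x∨y∧x≡𝟘∧y∨x x y = begin
    x ∨ (y ∧ x)  ≡⟨ sym ([𝟙∨x]∧y≡y∨x∧y y x) ⟩
    (𝟙 ∨ y) ∧ x  ≡⟨ cong (_∧ x) (sym (x∨𝟙≡𝟙∨x y)) ⟩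
    (y ∨ 𝟙) ∧ x  ≡⟨ [x∨𝟙]∧y≡𝟘∧x∨y y x ⟩
    (𝟘 ∧ y) ∨ x  ∎

  𝟙∨x∧y≡x∧𝟘∨𝟙∨y : ∀ x y → 𝟙 ∨ (x ∧ y) ≡ (x ∧ 𝟘) ∨ (𝟙 ∨ y)
  𝟙∨x∧y≡x∧𝟘∨𝟙∨y x y = begin
    𝟙 ∨ (x ∧ y)              ≡⟨ sym (x∨𝟙≡𝟙∨x (x ∧ y)) ⟩
    (x ∧ y) ∨ 𝟙              ≡⟨ ∨-distribʳ-∧ x y 𝟙 ⟩
    (𝟙 ∨ x) ∧ (y ∨ 𝟙)        ≡⟨ cong ((𝟙 ∨ x) ∧_) (x∨𝟙≡𝟙∨x y) ⟩
    (𝟙 ∨ x) ∧ (𝟙 ∨ y)        ≡⟨ sym ([x∨y]∧x≡[𝟙∨y]∧x (𝟙 ∨ y) x) ⟩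
    ((𝟙 ∨ y) ∨ x) ∧ (𝟙 ∨ y)  ≡⟨ sym (x∧𝟘∨y≡[y∨x]∧y x (𝟙 ∨ y)) ⟩
    (x ∧ 𝟘) ∨ (𝟙 ∨ y)        ∎

  𝟘∧[x∨y]≡[x∨𝟙]∧𝟘∧y : ∀ x y → 𝟘 ∧ (x ∨ y) ≡ (x ∨ 𝟙) ∧ (𝟘 ∧ y)
  𝟘∧[x∨y]≡[x∨𝟙]∧𝟘∧y = duality₂ (𝟙ᵉ ∨ᵉ (v₀ ∧ᵉ v₁)) ((v₀ ∧ᵉ 𝟘ᵉ) ∨ᵉ (𝟙ᵉ ∨ᵉ v₁)) 𝟙∨x∧y≡x∧𝟘∨𝟙∨y

  𝟙∨x∧y∧𝟘≡𝟙∨x∧y : ∀ x y → 𝟙 ∨ (x ∧ (y ∧ 𝟘)) ≡ 𝟙 ∨ (x ∧ y)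
  𝟙∨x∧y∧𝟘≡𝟙∨x∧y x y = begin
    𝟙 ∨ (x ∧ (y ∧ 𝟘))        ≡⟨ sym (x∨𝟙≡𝟙∨x (x ∧ (y ∧ 𝟘))) ⟩
    (x ∧ (y ∧ 𝟘)) ∨ 𝟙        ≡⟨ ∨-distribʳ-∧ x (y ∧ 𝟘) 𝟙 ⟩
    (𝟙 ∨ x) ∧ ((y ∧ 𝟘) ∨ 𝟙)  ≡⟨ cong ((𝟙 ∨ x) ∧_) (x∧𝟘∨𝟙≡𝟙∨x y) ⟩
    (𝟙 ∨ x) ∧ (𝟙 ∨ y)        ≡⟨ sym ([x∨y]∧x≡[𝟙∨y]∧x (𝟙 ∨ y) x) ⟩
    ((𝟙 ∨ y) ∨ x) ∧ (𝟙 ∨ y)  ≡⟨ sym (x∧𝟘∨y≡[y∨x]∧y x (𝟙 ∨ y)) ⟩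
    (x ∧ 𝟘) ∨ (𝟙 ∨ y)        ≡⟨ sym (𝟙∨x∧y≡x∧𝟘∨𝟙∨y x y) ⟩
    𝟙 ∨ (x ∧ y)              ∎

  𝟘∧[x∨y∨𝟙]≡𝟘∧[x∨y] : ∀ x y → 𝟘 ∧ (x ∨ (y ∨ 𝟙)) ≡ 𝟘 ∧ (x ∨ y)
  𝟘∧[x∨y∨𝟙]≡𝟘∧[x∨y] = duality₂ (𝟙ᵉ ∨ᵉ (v₀ ∧ᵉ (v₁ ∧ᵉ 𝟘ᵉ))) (𝟙ᵉ ∨ᵉ (v₀ ∧ᵉ v₁)) 𝟙∨x∧y∧𝟘≡𝟙∨x∧y

  𝟘∧x∨𝟙≡x∨𝟙 : ∀ x → (𝟘 ∧ x) ∨ 𝟙 ≡ x ∨ 𝟙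
  𝟘∧x∨𝟙≡x∨𝟙 x = begin
    (𝟘 ∧ x) ∨ 𝟙  ≡⟨ 𝟘∧x∨y≡y∧[x∨y] x 𝟙 ⟩
    𝟙 ∧ (x ∨ 𝟙)  ≡⟨ ∧-identityˡ (x ∨ 𝟙) ⟩
    x ∨ 𝟙        ∎

  𝟙∨𝟘∧x≡x∨𝟙 : ∀ x → 𝟙 ∨ (𝟘 ∧ x) ≡ x ∨ 𝟙
  𝟙∨𝟘∧x≡x∨𝟙 x = begin
    𝟙 ∨ (𝟘 ∧ x)  ≡⟨ sym (x∨𝟙≡𝟙∨x (𝟘 ∧ x)) ⟩
    (𝟘 ∧ x) ∨ 𝟙  ≡⟨ 𝟘∧x∨𝟙≡x∨𝟙 x ⟩
    x ∨ 𝟙        ∎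

  𝟘∧[𝟙∨x]≡x∧𝟘 : ∀ x → 𝟘 ∧ (𝟙 ∨ x) ≡ x ∧ 𝟘
  𝟘∧[𝟙∨x]≡x∧𝟘 = duality₁ (𝟙ᵉ ∨ᵉ (𝟘ᵉ ∧ᵉ v₀)) (v₀ ∨ᵉ 𝟙ᵉ) 𝟙∨𝟘∧x≡x∨𝟙

  𝟙∨𝟘∧x∨y≡𝟙∨x∧y : ∀ x y → 𝟙 ∨ ((𝟘 ∧ x) ∨ y) ≡ 𝟙 ∨ (x ∧ y)
  𝟙∨𝟘∧x∨y≡𝟙∨x∧y x y = begin
    𝟙 ∨ ((𝟘 ∧ x) ∨ y)              ≡⟨ cong (𝟙 ∨_) (sym ([x∨𝟙]∧y≡𝟘∧x∨y x y)) ⟩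
    𝟙 ∨ ((x ∨ 𝟙) ∧ y)              ≡⟨ sym (x∨𝟙≡𝟙∨x ((x ∨ 𝟙) ∧ y)) ⟩
    ((x ∨ 𝟙) ∧ y) ∨ 𝟙              ≡⟨ ∨-distribʳ-∧ (x ∨ 𝟙) y 𝟙 ⟩
    (𝟙 ∨ (x ∨ 𝟙)) ∧ (y ∨ 𝟙)        ≡⟨ cong (_∧ (y ∨ 𝟙)) (sym (x∧𝟘∨𝟙≡𝟙∨x (x ∨ 𝟙))) ⟩
    (((x ∨ 𝟙) ∧ 𝟘) ∨ 𝟙) ∧ (y ∨ 𝟙)  ≡⟨ cong (_∧ (y ∨ 𝟙)) (x∨𝟙≡𝟙∨x ((x ∨ 𝟙) ∧ 𝟘)) ⟩
    (𝟙 ∨ ((x ∨ 𝟙) ∧ 𝟘)) ∧ (y ∨ 𝟙)  ≡⟨ cong (λ h → (𝟙 ∨ h) ∧ (y ∨ 𝟙)) ([x∨𝟙]∧𝟘≡𝟘∧x x) ⟩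
    (𝟙 ∨ (𝟘 ∧ x)) ∧ (y ∨ 𝟙)        ≡⟨ cong (_∧ (y ∨ 𝟙)) (𝟙∨𝟘∧x≡x∨𝟙 x) ⟩
    (x ∨ 𝟙) ∧ (y ∨ 𝟙)              ≡⟨ cong (_∧ (y ∨ 𝟙)) (x∨𝟙≡𝟙∨x x) ⟩
    (𝟙 ∨ x) ∧ (y ∨ 𝟙)              ≡⟨ sym (∨-distribʳ-∧ x y 𝟙) ⟩
    (x ∧ y) ∨ 𝟙                    ≡⟨ x∨𝟙≡𝟙∨x (x ∧ y) ⟩
    𝟙 ∨ (x ∧ y)                    ∎

  𝟙∨x∧y≡𝟙∨x∨y : ∀ x y → 𝟙 ∨ (x ∧ y) ≡ 𝟙 ∨ (x ∨ y)
  𝟙∨x∧y≡𝟙∨x∨y x y = begin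
    𝟙 ∨ (x ∧ y)                    ≡⟨ sym (𝟙∨𝟘∧x∨y≡𝟙∨x∧y x y) ⟩
    𝟙 ∨ ((𝟘 ∧ x) ∨ y)              ≡⟨ cong (𝟙 ∨_) (𝟘∧x∨y≡y∧[x∨y] x y) ⟩
    𝟙 ∨ (y ∧ (x ∨ y))              ≡⟨ sym (𝟙∨𝟘∧x∨y≡𝟙∨x∧y y (x ∨ y)) ⟩
    𝟙 ∨ ((𝟘 ∧ y) ∨ (x ∨ y))        ≡⟨ cong (λ h → 𝟙 ∨ (h ∨ (x ∨ y))) (sym (x∧𝟘≡𝟘∧x y)) ⟩
    𝟙 ∨ ((y ∧ 𝟘) ∨ (x ∨ y))        ≡⟨ cong (𝟙 ∨_) (x∧𝟘∨y≡[y∨x]∧y y (x ∨ y)) ⟩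
    𝟙 ∨ (((x ∨ y) ∨ y) ∧ (x ∨ y))  ≡⟨ cong (𝟙 ∨_) ([x∨y]∧x≡[𝟙∨y]∧x (x ∨ y) y) ⟩
    𝟙 ∨ ((𝟙 ∨ y) ∧ (x ∨ y))        ≡⟨ cong (λ h → 𝟙 ∨ (h ∧ (x ∨ y))) (sym (x∨𝟙≡𝟙∨x y)) ⟩
    𝟙 ∨ ((y ∨ 𝟙) ∧ (x ∨ y))        ≡⟨ cong (𝟙 ∨_) (sym (∨-distribʳ-∧ 𝟙 x y)) ⟩
    𝟙 ∨ ((𝟙 ∧ x) ∨ y)              ≡⟨ cong (λ h → 𝟙 ∨ (h ∨ y)) (∧-identityˡ x) ⟩
    𝟙 ∨ (x ∨ y)                    ∎

  𝟘∧[x∨y]≡𝟘∧x∧y : ∀ x y → 𝟘 ∧ (x ∨ y) ≡ 𝟘 ∧ (x ∧ y)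
  𝟘∧[x∨y]≡𝟘∧x∧y = duality₂ (𝟙ᵉ ∨ᵉ (v₀ ∧ᵉ v₁)) (𝟙ᵉ ∨ᵉ (v₀ ∨ᵉ v₁)) 𝟙∨x∧y≡𝟙∨x∨y

  module ⊑-Props {p q : Carrier} (p⊑q : p ⊑ q) where

    q∧p≡p : q ∧ p ≡ p
    q∧p≡p = begin
      q ∧ p              ≡⟨ cong (_∧ p) (sym (∨-identityʳ q)) ⟩
      (q ∨ 𝟘) ∧ p        ≡⟨ ∧-distribʳ-∨ q 𝟘 p ⟩
      (p ∧ q) ∨ (𝟘 ∧ p)  ≡⟨ cong (_∨ (𝟘 ∧ p)) p⊑q ⟩
      p ∨ (𝟘 ∧ p)        ≡⟨ sym ([𝟙∨x]∧y≡y∨x∧y 𝟘 p) ⟩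
      (𝟙 ∨ 𝟘) ∧ p        ≡⟨ cong (_∧ p) (∨-identityʳ 𝟙) ⟩
      𝟙 ∧ p              ≡⟨ ∧-identityˡ p ⟩
      p                  ∎

    q∨p≡p∨q : q ∨ p ≡ p ∨ q
    q∨p≡p∨q = begin
      q ∨ p        ≡⟨ cong (q ∨_) (sym p⊑q) ⟩
      q ∨ (p ∧ q)  ≡⟨ x∨y∧x≡𝟘∧y∨x q p ⟩
      (𝟘 ∧ p) ∨ q  ≡⟨ sym (x∧y∨x≡𝟘∧y∨x q p) ⟩
      (q ∧ p) ∨ q  ≡⟨ cong (_∨ q) q∧p≡p ⟩
      p ∨ q        ∎

    q∧𝟘∨p≡p : (q ∧ 𝟘) ∨ p ≡ p
    q∧𝟘∨p≡p = begin
      (q ∧ 𝟘) ∨ p        ≡⟨ cong ((q ∧ 𝟘) ∨_) (sym p⊑q) ⟩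
      (q ∧ 𝟘) ∨ (p ∧ q)  ≡⟨ sym (∧-distribʳ-∨ 𝟘 p q) ⟩
      (𝟘 ∨ p) ∧ q        ≡⟨ cong (_∧ q) (∨-identityˡ p) ⟩
      p ∧ q              ≡⟨ p⊑q ⟩
      p                  ∎

    p∨𝟘∧q≡p : p ∨ (𝟘 ∧ q) ≡ p
    p∨𝟘∧q≡p = begin
      p ∨ (𝟘 ∧ q)        ≡⟨ cong (_∨ (𝟘 ∧ q)) (sym q∧p≡p) ⟩
      (q ∧ p) ∨ (𝟘 ∧ q)  ≡⟨ sym (∧-distribʳ-∨ p 𝟘 q) ⟩
      (p ∨ 𝟘) ∧ q        ≡⟨ cong (_∧ q) (∨-identityʳ p) ⟩
      p ∧ q              ≡⟨ p⊑q ⟩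
      p                  ∎

    𝟘∧[q∨p]≡𝟘∧p : 𝟘 ∧ (q ∨ p) ≡ 𝟘 ∧ p
    𝟘∧[q∨p]≡𝟘∧p = begin
      𝟘 ∧ (q ∨ p)                                      ≡⟨ cong (𝟘 ∧_) q∨p≡p∨q ⟩
      𝟘 ∧ (p ∨ q)                                      ≡⟨ sym (𝟘∧[x∨y∨𝟙]≡𝟘∧[x∨y] p q) ⟩
      𝟘 ∧ (p ∨ (q ∨ 𝟙))                                ≡⟨ cong (λ h → 𝟘 ∧ (p ∨ h)) (x∨𝟙≡𝟙∨x q) ⟩
      𝟘 ∧ (p ∨ (𝟙 ∨ q))
        ≡⟨ cong (λ h → 𝟘 ∧ (h ∨ (𝟙 ∨ q))) (sym p∨𝟘∧q≡p) ⟩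
      𝟘 ∧ ((p ∨ (𝟘 ∧ q)) ∨ (𝟙 ∨ q))
        ≡⟨ cong (λ h → 𝟘 ∧ ((p ∨ h) ∨ (𝟙 ∨ q))) (sym (x∧𝟘≡𝟘∧x q)) ⟩
      𝟘 ∧ ((p ∨ (q ∧ 𝟘)) ∨ (𝟙 ∨ q))
        ≡⟨ cong (λ h → 𝟘 ∧ (h ∨ (𝟙 ∨ q))) (x∨y≡[y∨x]∧[y∨𝟙] p (q ∧ 𝟘)) ⟩
      𝟘 ∧ ((((q ∧ 𝟘) ∨ p) ∧ ((q ∧ 𝟘) ∨ 𝟙)) ∨ (𝟙 ∨ q))
        ≡⟨ cong (λ h → 𝟘 ∧ ((h ∧ ((q ∧ 𝟘) ∨ 𝟙)) ∨ (𝟙 ∨ q))) q∧𝟘∨p≡p ⟩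
      𝟘 ∧ ((p ∧ ((q ∧ 𝟘) ∨ 𝟙)) ∨ (𝟙 ∨ q))
        ≡⟨ cong (λ h → 𝟘 ∧ ((p ∧ h) ∨ (𝟙 ∨ q))) (x∧𝟘∨𝟙≡𝟙∨x q) ⟩
      𝟘 ∧ ((p ∧ (𝟙 ∨ q)) ∨ (𝟙 ∨ q))                    ≡⟨ cong (𝟘 ∧_) (x∧y∨y≡x∧𝟘∨y p (𝟙 ∨ q)) ⟩
      𝟘 ∧ ((p ∧ 𝟘) ∨ (𝟙 ∨ q))                          ≡⟨ cong (𝟘 ∧_) (sym (𝟙∨x∧y≡x∧𝟘∨𝟙∨y p q)) ⟩
      𝟘 ∧ (𝟙 ∨ (p ∧ q))                                ≡⟨ cong (λ h → 𝟘 ∧ (𝟙 ∨ h)) p⊑q ⟩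
      𝟘 ∧ (𝟙 ∨ p)                                      ≡⟨ 𝟘∧[𝟙∨x]≡x∧𝟘 p ⟩
      p ∧ 𝟘                                            ≡⟨ x∧𝟘≡𝟘∧x p ⟩
      𝟘 ∧ p                                            ∎

  module Transitivity {a b c : Carrier} (h₁ : a ⊑ b) (h₂ : b ⊑ c) where
    -- After c ∧ a ≡ a, twisted commutativity gives a ∧ c ≡ a ∨ (𝟘 ∧ c); the summand 𝟘 ∧ c is
    -- then absorbed because 𝟙 ∨ a ≡ 𝟙 ∨ (a ∨ c).
    module AB = ⊑-Props h₁
    module BC = ⊑-Props h₂

    a∨c≡c∨a∧c : a ∨ c ≡ c ∨ (a ∧ c)
    a∨c≡c∨a∧c = begin
      a ∨ c                          ≡⟨ cong (_∨ c) (sym h₁) ⟩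
      (a ∧ b) ∨ c                    ≡⟨ ∨-distribʳ-∧ a b c ⟩
      (c ∨ a) ∧ (b ∨ c)              ≡⟨ cong (λ h → (c ∨ a) ∧ (h ∨ c)) (sym BC.q∧p≡p) ⟩
      (c ∨ a) ∧ ((c ∧ b) ∨ c)        ≡⟨ cong ((c ∨ a) ∧_) (x∧y∨x≡𝟘∧y∨x c b) ⟩
      (c ∨ a) ∧ ((𝟘 ∧ b) ∨ c)        ≡⟨ sym (∨-distribʳ-∧ a (𝟘 ∧ b) c) ⟩
      (a ∧ (𝟘 ∧ b)) ∨ c              ≡⟨ cong (λ h → (a ∧ h) ∨ c) (sym (x∧𝟘≡𝟘∧x b)) ⟩
      (a ∧ (b ∧ 𝟘)) ∨ c              ≡⟨ cong (λ h → (h ∧ (b ∧ 𝟘)) ∨ c) (sym AB.q∧𝟘∨p≡p) ⟩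
      (((b ∧ 𝟘) ∨ a) ∧ (b ∧ 𝟘)) ∨ c  ≡⟨ cong (_∨ c) ([x∨y]∧x≡[y∨𝟙]∧x (b ∧ 𝟘) a) ⟩
      ((a ∨ 𝟙) ∧ (b ∧ 𝟘)) ∨ c        ≡⟨ cong (_∨ c) ([x∨𝟙]∧y≡𝟘∧x∨y a (b ∧ 𝟘)) ⟩
      ((𝟘 ∧ a) ∨ (b ∧ 𝟘)) ∨ c        ≡⟨ cong (_∨ c) (sym (∧-distribʳ-∨ a b 𝟘)) ⟩
      ((a ∨ b) ∧ 𝟘) ∨ c              ≡⟨ cong (_∨ c) (x∧𝟘≡𝟘∧x (a ∨ b)) ⟩
      (𝟘 ∧ (a ∨ b)) ∨ c              ≡⟨ cong (λ h → (𝟘 ∧ h) ∨ c) (sym AB.q∨p≡p∨q) ⟩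
      (𝟘 ∧ (b ∨ a)) ∨ c              ≡⟨ cong (_∨ c) AB.𝟘∧[q∨p]≡𝟘∧p ⟩
      (𝟘 ∧ a) ∨ c                    ≡⟨ sym (x∨y∧x≡𝟘∧y∨x c a) ⟩
      c ∨ (a ∧ c)                    ∎

    a∨[𝟘∧c]∧a≡a : a ∨ ((𝟘 ∧ c) ∧ a) ≡ a
    a∨[𝟘∧c]∧a≡a = begin
      a ∨ ((𝟘 ∧ c) ∧ a)        ≡⟨ cong (λ h → a ∨ (h ∧ a)) (sym (x∧𝟘≡𝟘∧x c)) ⟩
      a ∨ ((c ∧ 𝟘) ∧ a)        ≡⟨ x∨y∧x≡𝟘∧y∨x a (c ∧ 𝟘) ⟩
      (𝟘 ∧ (c ∧ 𝟘)) ∨ a        ≡⟨ sym (x∧y∨x≡𝟘∧y∨x a (c ∧ 𝟘)) ⟩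
      (a ∧ (c ∧ 𝟘)) ∨ a        ≡⟨ cong ((a ∧ (c ∧ 𝟘)) ∨_) (sym AB.q∧p≡p) ⟩
      (a ∧ (c ∧ 𝟘)) ∨ (b ∧ a)  ≡⟨ sym (∧-distribʳ-∨ (c ∧ 𝟘) b a) ⟩
      ((c ∧ 𝟘) ∨ b) ∧ a        ≡⟨ cong (_∧ a) BC.q∧𝟘∨p≡p ⟩
      b ∧ a                    ≡⟨ AB.q∧p≡p ⟩
      a                        ∎

    c∧a≡a : c ∧ a ≡ a
    c∧a≡a = begin
      c ∧ a                    ≡⟨ cong (_∧ a) (sym (∨-identityˡ c)) ⟩
      (𝟘 ∨ c) ∧ a              ≡⟨ ∧-distribʳ-∨ 𝟘 c a ⟩
      (a ∧ 𝟘) ∨ (c ∧ a)        ≡⟨ sym (x∧y∨y≡x∧𝟘∨y a (c ∧ a)) ⟩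
      (a ∧ (c ∧ a)) ∨ (c ∧ a)  ≡⟨ sym (∧-distribʳ-∨ (c ∧ a) c a) ⟩
      ((c ∧ a) ∨ c) ∧ a        ≡⟨ cong (_∧ a) (x∧y∨x≡x∨y∧x c a) ⟩
      (c ∨ (a ∧ c)) ∧ a        ≡⟨ cong (_∧ a) (sym a∨c≡c∨a∧c) ⟩
      (a ∨ c) ∧ a              ≡⟨ ∧-distribʳ-∨ a c a ⟩
      (a ∧ a) ∨ (c ∧ a)        ≡⟨ cong (_∨ (c ∧ a)) (x∧x≡x a) ⟩
      a ∨ (c ∧ a)              ≡⟨ x∨y∧x≡𝟘∧y∨x a c ⟩
      (𝟘 ∧ c) ∨ a              ≡⟨ sym ([x∨𝟙]∧y≡𝟘∧x∨y c a) ⟩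
      (c ∨ 𝟙) ∧ a              ≡⟨ cong (_∧ a) (sym (𝟘∧x∨𝟙≡x∨𝟙 c)) ⟩
      ((𝟘 ∧ c) ∨ 𝟙) ∧ a        ≡⟨ [x∨𝟙]∧y≡y∧x∨y (𝟘 ∧ c) a ⟩
      (a ∧ (𝟘 ∧ c)) ∨ a        ≡⟨ x∧y∨x≡x∨y∧x a (𝟘 ∧ c) ⟩
      a ∨ ((𝟘 ∧ c) ∧ a)        ≡⟨ a∨[𝟘∧c]∧a≡a ⟩
      a                        ∎

    a∧c≡a∨𝟘∧c : a ∧ c ≡ a ∨ (𝟘 ∧ c)
    a∧c≡a∨𝟘∧c = begin
      a ∧ c              ≡⟨ x∧y≡y∧x∨y∧𝟘 a c ⟩
      (c ∧ a) ∨ (c ∧ 𝟘)  ≡⟨ cong (_∨ (c ∧ 𝟘)) c∧a≡a ⟩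
      a ∨ (c ∧ 𝟘)        ≡⟨ cong (a ∨_) (x∧𝟘≡𝟘∧x c) ⟩
      a ∨ (𝟘 ∧ c)        ∎

    [a∧c]∧b≡a : (a ∧ c) ∧ b ≡ a
    [a∧c]∧b≡a = begin
      (a ∧ c) ∧ b                    ≡⟨ cong (_∧ b) a∧c≡a∨𝟘∧c ⟩
      (a ∨ (𝟘 ∧ c)) ∧ b              ≡⟨ ∧-distribʳ-∨ a (𝟘 ∧ c) b ⟩
      (b ∧ a) ∨ ((𝟘 ∧ c) ∧ b)        ≡⟨ cong (_∨ ((𝟘 ∧ c) ∧ b)) AB.q∧p≡p ⟩
      a ∨ ((𝟘 ∧ c) ∧ b)              ≡⟨ cong (λ h → a ∨ ((𝟘 ∧ c) ∧ h)) (sym BC.p∨𝟘∧q≡p) ⟩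
      a ∨ ((𝟘 ∧ c) ∧ (b ∨ (𝟘 ∧ c)))  ≡⟨ cong (a ∨_) (sym (𝟘∧x∨y≡y∧[x∨y] b (𝟘 ∧ c))) ⟩
      a ∨ ((𝟘 ∧ b) ∨ (𝟘 ∧ c))        ≡⟨ cong (a ∨_) (sym ([x∨𝟙]∧y≡𝟘∧x∨y b (𝟘 ∧ c))) ⟩
      a ∨ ((b ∨ 𝟙) ∧ (𝟘 ∧ c))        ≡⟨ cong (a ∨_) (sym (𝟘∧[x∨y]≡[x∨𝟙]∧𝟘∧y b c)) ⟩
      a ∨ (𝟘 ∧ (b ∨ c))              ≡⟨ cong (λ h → a ∨ (𝟘 ∧ (h ∨ c))) (sym BC.q∧p≡p) ⟩
      a ∨ (𝟘 ∧ ((c ∧ b) ∨ c))        ≡⟨ cong (λ h → a ∨ (𝟘 ∧ h)) (x∧y∨x≡𝟘∧y∨x c b) ⟩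
      a ∨ (𝟘 ∧ ((𝟘 ∧ b) ∨ c))        ≡⟨ cong (λ h → a ∨ (𝟘 ∧ h)) (sym (x∨y∧x≡𝟘∧y∨x c b)) ⟩
      a ∨ (𝟘 ∧ (c ∨ (b ∧ c)))        ≡⟨ cong (λ h → a ∨ (𝟘 ∧ (c ∨ h))) h₂ ⟩
      a ∨ (𝟘 ∧ (c ∨ b))              ≡⟨ cong (a ∨_) BC.𝟘∧[q∨p]≡𝟘∧p ⟩
      a ∨ (𝟘 ∧ b)                    ≡⟨ AB.p∨𝟘∧q≡p ⟩
      a                              ∎

    a∧c≡a∨𝟘∧a∧c : a ∧ c ≡ a ∨ (𝟘 ∧ (a ∧ c))
    a∧c≡a∨𝟘∧a∧c = begin
      a ∧ c                          ≡⟨ a∧c≡a∨𝟘∧c ⟩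
      a ∨ (𝟘 ∧ c)                    ≡⟨ cong (_∨ (𝟘 ∧ c)) (sym AB.q∧p≡p) ⟩
      (b ∧ a) ∨ (𝟘 ∧ c)              ≡⟨ cong ((b ∧ a) ∨_) (sym (x∧𝟘≡𝟘∧x c)) ⟩
      (b ∧ a) ∨ (c ∧ 𝟘)              ≡⟨ ∨-distribʳ-∧ b a (c ∧ 𝟘) ⟩
      ((c ∧ 𝟘) ∨ b) ∧ (a ∨ (c ∧ 𝟘))  ≡⟨ cong (_∧ (a ∨ (c ∧ 𝟘))) BC.q∧𝟘∨p≡p ⟩
      b ∧ (a ∨ (c ∧ 𝟘))              ≡⟨ cong (λ h → b ∧ (a ∨ h)) (x∧𝟘≡𝟘∧x c) ⟩
      b ∧ (a ∨ (𝟘 ∧ c))              ≡⟨ cong (b ∧_) (sym a∧c≡a∨𝟘∧c) ⟩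
      b ∧ (a ∧ c)                    ≡⟨ x∧y≡y∧x∨y∧𝟘 b (a ∧ c) ⟩
      ((a ∧ c) ∧ b) ∨ ((a ∧ c) ∧ 𝟘)  ≡⟨ cong (_∨ ((a ∧ c) ∧ 𝟘)) [a∧c]∧b≡a ⟩
      a ∨ ((a ∧ c) ∧ 𝟘)              ≡⟨ cong (a ∨_) (x∧𝟘≡𝟘∧x (a ∧ c)) ⟩
      a ∨ (𝟘 ∧ (a ∧ c))              ∎

    b∨a∧c≡b∨a : b ∨ (a ∧ c) ≡ b ∨ a
    b∨a∧c≡b∨a = begin
      b ∨ (a ∧ c)        ≡⟨ cong (_∨ (a ∧ c)) (sym BC.q∧p≡p) ⟩
      (c ∧ b) ∨ (a ∧ c)  ≡⟨ sym (∧-distribʳ-∨ b a c) ⟩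
      (b ∨ a) ∧ c        ≡⟨ cong (_∧ c) AB.q∨p≡p∨q ⟩
      (a ∨ b) ∧ c        ≡⟨ ∧-distribʳ-∨ a b c ⟩
      (c ∧ a) ∨ (b ∧ c)  ≡⟨ cong ((c ∧ a) ∨_) h₂ ⟩
      (c ∧ a) ∨ b        ≡⟨ cong (_∨ b) c∧a≡a ⟩
      a ∨ b              ≡⟨ sym AB.q∨p≡p∨q ⟩
      b ∨ a              ∎

    𝟘∧b∨a∧c≡a∧c : (𝟘 ∧ b) ∨ (a ∧ c) ≡ a ∧ c
    𝟘∧b∨a∧c≡a∧c = begin
      (𝟘 ∧ b) ∨ (a ∧ c)        ≡⟨ sym ([x∨𝟙]∧y≡𝟘∧x∨y b (a ∧ c)) ⟩
      (b ∨ 𝟙) ∧ (a ∧ c)        ≡⟨ [x∨𝟙]∧y≡y∧x∨y b (a ∧ c) ⟩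
      ((a ∧ c) ∧ b) ∨ (a ∧ c)  ≡⟨ cong (_∨ (a ∧ c)) [a∧c]∧b≡a ⟩
      a ∨ (a ∧ c)              ≡⟨ cong (_∨ (a ∧ c)) (sym c∧a≡a) ⟩
      (c ∧ a) ∨ (a ∧ c)        ≡⟨ sym (∧-distribʳ-∨ a a c) ⟩
      (a ∨ a) ∧ c              ≡⟨ cong (_∧ c) (x∨x≡x a) ⟩
      a ∧ c                    ∎

    𝟙∨a≡𝟙∨a∨c : 𝟙 ∨ a ≡ 𝟙 ∨ (a ∨ c)
    𝟙∨a≡𝟙∨a∨c = begin
      𝟙 ∨ a                    ≡⟨ sym (x∨𝟙≡𝟙∨x a) ⟩
      a ∨ 𝟙                    ≡⟨ sym (𝟘∧x∨𝟙≡x∨𝟙 a) ⟩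
      (𝟘 ∧ a) ∨ 𝟙              ≡⟨ cong (_∨ 𝟙) (sym AB.𝟘∧[q∨p]≡𝟘∧p) ⟩
      (𝟘 ∧ (b ∨ a)) ∨ 𝟙        ≡⟨ 𝟘∧x∨𝟙≡x∨𝟙 (b ∨ a) ⟩
      (b ∨ a) ∨ 𝟙              ≡⟨ x∨𝟙≡𝟙∨x (b ∨ a) ⟩
      𝟙 ∨ (b ∨ a)              ≡⟨ cong (𝟙 ∨_) (sym b∨a∧c≡b∨a) ⟩
      𝟙 ∨ (b ∨ (a ∧ c))        ≡⟨ sym (𝟙∨x∧y≡𝟙∨x∨y b (a ∧ c)) ⟩
      𝟙 ∨ (b ∧ (a ∧ c))        ≡⟨ sym (𝟙∨𝟘∧x∨y≡𝟙∨x∧y b (a ∧ c)) ⟩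
      𝟙 ∨ ((𝟘 ∧ b) ∨ (a ∧ c))  ≡⟨ cong (𝟙 ∨_) 𝟘∧b∨a∧c≡a∧c ⟩
      𝟙 ∨ (a ∧ c)              ≡⟨ sym (𝟙∨𝟘∧x∨y≡𝟙∨x∧y a c) ⟩
      𝟙 ∨ ((𝟘 ∧ a) ∨ c)        ≡⟨ cong (𝟙 ∨_) (sym (x∧y∨x≡𝟘∧y∨x c a)) ⟩
      𝟙 ∨ ((c ∧ a) ∨ c)        ≡⟨ cong (𝟙 ∨_) (x∧y∨x≡x∨y∧x c a) ⟩
      𝟙 ∨ (c ∨ (a ∧ c))        ≡⟨ cong (𝟙 ∨_) (sym a∨c≡c∨a∧c) ⟩
      𝟙 ∨ (a ∨ c)              ∎

    a∧c≡a : a ∧ c ≡ a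
    a∧c≡a = begin
      a ∧ c                    ≡⟨ a∧c≡a∨𝟘∧a∧c ⟩
      a ∨ (𝟘 ∧ (a ∧ c))        ≡⟨ cong (a ∨_) (sym (𝟘∧[x∨y]≡𝟘∧x∧y a c)) ⟩
      a ∨ (𝟘 ∧ (a ∨ c))        ≡⟨ cong (a ∨_) (sym (x∧𝟘≡𝟘∧x (a ∨ c))) ⟩
      a ∨ ((a ∨ c) ∧ 𝟘)        ≡⟨ cong (a ∨_) (sym (𝟘∧[𝟙∨x]≡x∧𝟘 (a ∨ c))) ⟩
      a ∨ (𝟘 ∧ (𝟙 ∨ (a ∨ c)))  ≡⟨ cong (λ h → a ∨ (𝟘 ∧ h)) (sym 𝟙∨a≡𝟙∨a∨c) ⟩
      a ∨ (𝟘 ∧ (𝟙 ∨ a))        ≡⟨ cong (a ∨_) (𝟘∧[𝟙∨x]≡x∧𝟘 a) ⟩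
      a ∨ (a ∧ 𝟘)              ≡⟨ cong (a ∨_) (x∧𝟘≡𝟘∧x a) ⟩
      a ∨ (𝟘 ∧ a)              ≡⟨ sym ([𝟙∨x]∧y≡y∨x∧y 𝟘 a) ⟩
      (𝟙 ∨ 𝟘) ∧ a              ≡⟨ cong (_∧ a) (∨-identityʳ 𝟙) ⟩
      𝟙 ∧ a                    ≡⟨ ∧-identityˡ a ⟩
      a                        ∎

  ⊑-antisym : ∀ {p q} → p ⊑ q → q ⊑ p → p ≡ q
  ⊑-antisym p⊑q q⊑p = trans (sym (⊑-Props.q∧p≡p p⊑q)) q⊑p

  ⊑-isPartialOrder : IsPartialOrder _≡_ _⊑_
  ⊑-isPartialOrder = record
    { isPreorder = record
        { isEquivalence = isEquivalence
        ; reflexive     = λ { refl → x∧x≡x _ }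
        ; trans         = Transitivity.a∧c≡a
        }
    ; antisym    = ⊑-antisym
    }

theorem3p9 :
    ((A : Zroupoid) → IsI20 A → IsPartialOrder (_≡_ {A = Zroupoid.Carrier A}) (Zroupoid._⊑_ A))
    × ((Σ : Identities)
        → ((A : Zroupoid) → InSubvariety Σ A → IsPartialOrder (_≡_ {A = Zroupoid.Carrier A}) (Zroupoid._⊑_ A))
        → (A : Zroupoid) → InSubvariety Σ A → IsI20 A)
theorem3p9 = I20Properties.⊑-isPartialOrder , maximal
  where
  maximal : (Σ : Identities)
          → ((A : Zroupoid) → InSubvariety Σ A → IsPartialOrder _≡_ (Zroupoid._⊑_ A))
          → (A : Zroupoid) → InSubvariety Σ A → IsI20 A
  maximal Σ ⊑-po A A∈V = isI , Reflexive.′-involutive (λ x → IsPartialOrder.refl (⊑-po A A∈V))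
    where
    isI : IsIZroupoid A
    isI = proj₁ A∈V
    open IZroupoidProperties A isI
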